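{- Let $c,c'$ be well-formed GCL commands and $f,f'$ labels with $\mathsf{okf}(c,f)$ and $\mathsf{okf}(c',f')$. Let $L,R,J$ be live alignment conditions for the automata $A=\mathsf{aut}(c,f)$ and $A'=\mathsf{aut}(c',f')$, and let $\mathcal{S},\mathcal{T}$ be relations on variable stores. Suppose $an$ is a valid annotation of the alignment automaton $\prod(A,A',L,R,J)$ for the specification $\langle\mathcal{S}\rangle\langle\mathcal{T}\rangle$, and suppose that for every control point $(i,j)$ of this alignment automaton, $\widehat{an}(i,j)\subseteq L\cup R\cup J\cup[f|f']$. Then the relational judgment $c\mid c' : \langle\mathcal{S}\rangle\langle\mathcal{T}\rangle$ is derivable in the proof system RHL+.
   Context: Stores are total maps from a set of integer variables to $\mathbb{Z}$. GCL commands: $c ::= \mathsf{skip}^n \mid x :=^n e \mid c;c \mid \mathsf{if}^n\, gcs\,\mathsf{fi} \mid \mathsf{do}^n\, gcs\,\mathsf{od}$, with $gcs ::= e\to c \mid e\to c \,\square\, gcs$ (nonempty lists of guarded commands), $n\in\mathbb{Z}$ a label, $e$ an (always defined) integer or boolean expression; boolean expressions are built from primitive boolean expressions with $\wedge,\vee,\neg$, and $[\![e]\!](s)$ is the value of $e$ in store $s$. $\mathsf{enab}(gcs)$ is the disjunction of the guards of $gcs$. A command is well formed if it is well typed and every subcommand $\mathsf{if}^n\,gcs\,\mathsf{fi}$ has $\mathsf{enab}(gcs)$ true in every store. The denotation $[\![c]\!]\subseteq \mathrm{Store}\times\mathrm{Store}$ (labels ignored) is standard: identity for skip; $\{(s,s[x\mapsto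 [\![e]\!](s)])\}$ for $x:=e$; composition for $;$; for if, pairs $(s,t)$ with some $e\to d\in gcs$, $e$ true at $s$, $(s,t)\in[\![d]\!]$; for do, the reflexive-transitive closure of the if-relation of $gcs$ restricted to final stores where $\mathsf{enab}(gcs)$ is false. Labels: $\mathsf{lab}(c)$ is the label of $c$ (with $\mathsf{lab}(c;d)=\mathsf{lab}(c)$); $\mathsf{labs}(c)$ the set of all labels in $c$; $\mathsf{ok}(c)$ means all labels in $c$ are positive and pairwise distinct; $\mathsf{okf}(c,f)$ means $\mathsf{ok}(c)$ and $f\notin\mathsf{labs}(c)$; $\mathsf{sub}(n,c)$ is the subcommand of $c$ labelled $n$. Following successor: $\mathsf{fsuc}(n,\mathsf{skip}^n,f)=\mathsf{fsuc}(n,x:=^ne,f)=\mathsf{fsuc}(n,\mathsf{if}^n gcs\,\mathsf{fi},f)=\mathsf{fsuc}(n,\mathsf{do}^n gcs\,\mathsf{od},f)=f$; $\mathsf{fsuc}(n,c;d,f)=\mathsf{fsuc}(n,c,\mathsf{lab}(d))$ if $n\in\mathsf{labs}(c)$ and $\mathsf{fsuc}(n,d,f)$ otherwise; for $m\ne n$ in $\mathsf{labs}(d)$ with $e\to d$ in $gcs$: $\mathsf{fsuc}(m,\mathsf{if}^n gcs\,\mathsf{fi},f)=\mathsf{fsuc}(m,d,f)$ and $\mathsf{fsuc}(m,\mathsf{do}^n gcs\,\mathsf{od},f)=\mathsf{fsuc}(m,d,n)$. Small-step semantics on configurations $\langle c,s\rangle$: $\langle \mathsf{if}^n gcs\,\mathsf{fi},s\rangle\to\langle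 d,s\rangle$ and $\langle \mathsf{do}^n gcs\,\mathsf{od},s\rangle\to\langle d;\mathsf{do}^n gcs\,\mathsf{od},s\rangle$ if $e\to d\in gcs$ and $e$ true at $s$; $\langle\mathsf{do}^n gcs\,\mathsf{od},s\rangle\to\langle\mathsf{skip}^{ -n},s\rangle$ if $\mathsf{enab}(gcs)$ false at $s$; $\langle x:=^ne,s\rangle\to\langle\mathsf{skip}^{ -n},s[x\mapsto[\![e]\!](s)]\rangle$; $\langle \mathsf{skip}^n;c,s\rangle\to\langle c,s\rangle$; if $\langle c,s\rangle\to\langle d,t\rangle$ then $\langle c;b,s\rangle\to\langle d;b,t\rangle$. An automaton is $(Ctrl,Sto,init,fin,\Rightarrow)$ with $Ctrl$ finite, $init\ne fin$, ${\Rightarrow}\subseteq (Ctrl\times Sto)^2$, such that $(n,s)\Rightarrow(m,t)$ implies $n\ne fin$ and $n\ne m$; states are elements of $Ctrl\times Sto$. For $\mathsf{okf}(c,f)$, $\mathsf{aut}(c,f)=(\mathsf{labs}(c)\cup\{f\},\mathrm{Store},\mathsf{lab}(c),f,\Rightarrow)$ where $(n,s)\Rightarrow(m,t)$ iff either $\langle\mathsf{sub}(n,c),s\rangle\to\langle d,t\rangle$ with $\mathsf{lab}(d)>0$ and $m=\mathsf{lab}(d)$; or $\langle\mathsf{sub}(n,c),s\rangle\to\langle d,t\rangle$ with $\mathsf{lab}(d)<0$ and $m=\mathsf{fsuc}(n,c,f)$; or $\mathsf{sub}(n,c)=\mathsf{skip}^n$, $m=\mathsf{fsuc}(n,c,f)$,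 $t=s$. Alignment automaton: for automata $A,A'$ and $L,R,J\subseteq (Ctrl\times Ctrl')\times(Sto\times Sto')$, $\prod(A,A',L,R,J)$ has control $Ctrl\times Ctrl'$, stores $Sto\times Sto'$, initial $(init,init')$, final $(fin,fin')$, and $((n,n'),(s,s'))\Rightarrow((m,m'),(t,t'))$ iff: ($((n,n'),(s,s'))\in L$, $(n,s)\Rightarrow(m,t)$, $(n',s')=(m',t')$) or ($\in R$, $(n,s)=(m,t)$, $(n',s')\Rightarrow'(m',t')$) or ($\in J$, $(n,s)\Rightarrow(m,t)$, $(n',s')\Rightarrow'(m',t')$). $(L,R,J)$ is live if every state in $L$ has an $A$-successor on the left, every state in $R$ an $A'$-successor on the right, every state in $J$ both. $[n|n']$ is the set of states whose control is $(n,n')$. Annotation of an automaton for spec $\{P\}\{Q\}$: a map $an$ from control points to sets of stores with $an(init)=P$, $an(fin)=Q$; it is valid if for all control points $n,m$, whenever $s\in an(n)$ and $(n,s)\Rightarrow(m,t)$ then $t\in an(m)$. For an alignment automaton, an annotation for $\langle\mathcal{S}\rangle\langle\mathcal{T}\rangle$ is one for the unary spec $\{\mathcal{S}\}\{\mathcal{T}\}$ on its pair-stores. Lifting: $\widehat{an}(i,j)=\{((k,k'),(s,s')) : (s,s')\in an(i,j)\}$. Relational notation: predicates are sets of stores, relations sets of pairs of stores; a boolean expression $e$ stands for $\{s:[\![e]\!](s)=\mathrm{true}\}$; $P^{\mathrm{L}}=\{(s,s'):s\in P\}$, $P^{\mathrm{R}}=\{(s,s'):s'\in P\}$; $(e^{\mathrm{L}}=e'^{\mathrm{R}})=\{(s,s'):[\![e]\!](s)=[\![e']\!](s')\}$.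 Substitution: $s\in P[x:=e]$ iff $s[x\mapsto[\![e]\!](s)]\in P$; $(s,s')\in\mathcal{R}[x|x':=e|e']$ iff $(s[x\mapsto[\![e]\!](s)],s'[x'\mapsto[\![e']\!](s')])\in\mathcal{R}$, and $\mathcal{R}[x|\,:=e|\,]$, $\mathcal{R}[\,|x:=\,|e]$ substitute on one side. $\mathrm{indep}(x|x',\mathcal{R})$ means membership of $(s,s')$ in $\mathcal{R}$ is unchanged by changing $s(x)$ and $s'(x')$ arbitrarily. $\mathsf{ghost}(x,c)$ means $x$ occurs in $c$ only in assignments to $x$; $\mathsf{erase}(x,c)$ replaces each assignment to $x$ in $c$ by skip. Valid judgment $\models c\mid c':\langle\mathcal{R}\rangle\langle\mathcal{S}\rangle$: for all $(s,t)\in[\![c]\!]$, $(s',t')\in[\![c']\!]$, $(s,s')\in\mathcal{R}$ implies $(t,t')\in\mathcal{S}$. Command equivalence $c\cong d$: $\mathrm{Hyp}\vdash \mathcal{K}(c)=\mathcal{K}(d)$ in Kleene algebra with tests (KAT), where $\mathcal{K}$ translates commands to KAT expressions over atoms (primitive boolean expressions as tests, assignments as actions): $\mathcal{K}(b)=\underline{b}$, $\mathcal{K}(e\wedge e')=\mathcal{K}(e);\mathcal{K}(e')$, $\mathcal{K}(e\vee e')=\mathcal{K}(e)+\mathcal{K}(e')$, $\mathcal{K}(\neg e)=\neg\mathcal{K}(e)$, $\mathcal{K}(x:=e)=\underline{x:=e}$, $\mathcal{K}(\mathsf{skip})=1$, $\mathcal{K}(c;d)=\mathcal{K}(c);\mathcal{K}(d)$,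 $\mathcal{K}(gcs)=\sum_{e\to c\in gcs}\mathcal{K}(e);\mathcal{K}(c)$, $\mathcal{K}(\mathsf{if}\,gcs\,\mathsf{fi})=\mathcal{K}(gcs)$, $\mathcal{K}(\mathsf{do}\,gcs\,\mathsf{od})=\mathcal{K}(gcs)^*;\neg\mathcal{K}(\mathsf{enab}(gcs))$; and $\mathrm{Hyp}$ consists of $\mathcal{K}(e)=0$ for every boolean $e$ false in all stores, and $\mathcal{K}(e_0);\underline{x:=e};\neg\mathcal{K}(e_1)=0$ whenever $e_0\Rightarrow e_1[x:=e]$ is valid; $\vdash$ is derivability from the KAT axioms (Boolean algebra on tests, idempotent semiring, $1+xx^*=x^*$, $1+x^*x=x^*$, $y+xz\le z\Rightarrow x^*y\le z$, $y+zx\le z\Rightarrow yx^*\le z$, with $x\le y$ iff $x+y=y$) plus the hypotheses. RHL+ rules (entailments $\Rightarrow$ are set inclusions): rRewrite: from $c\mid c':\langle\mathcal{R}\rangle\langle\mathcal{S}\rangle$, $c\cong d$, $c'\cong d'$ infer $d\mid d':\langle\mathcal{R}\rangle\langle\mathcal{S}\rangle$. rGhost: from $c\mid c':\langle\mathcal{R}\rangle\langle\mathcal{S}\rangle$, $\mathsf{ghost}(x,c)$, $\mathsf{ghost}(x',c')$, $\mathrm{indep}(x|x',\mathcal{R})$, $\mathrm{indep}(x|x',\mathcal{S})$ infer $\mathsf{erase}(x,c)\mid\mathsf{erase}(x',c'):\langle\mathcal{R}\rangle\langle\mathcal{S}\rangle$. dIf: from $c\mid c':\langle\mathcal{R}\wedge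 e^{\mathrm{L}}\wedge e'^{\mathrm{R}}\rangle\langle\mathcal{S}\rangle$ for all $e\to c\in gcs$, $e'\to c'\in gcs'$ infer $\mathsf{if}\,gcs\,\mathsf{fi}\mid\mathsf{if}\,gcs'\,\mathsf{fi}:\langle\mathcal{R}\rangle\langle\mathcal{S}\rangle$. dAsgn: $x:=e\mid x':=e':\langle\mathcal{R}[x|x':=e|e']\rangle\langle\mathcal{R}\rangle$. AsgnSkip: $x:=e\mid\mathsf{skip}:\langle\mathcal{R}[x|\,:=e|\,]\rangle\langle\mathcal{R}\rangle$. SkipAsgn: $\mathsf{skip}\mid x:=e:\langle\mathcal{R}[\,|x:=\,|e]\rangle\langle\mathcal{R}\rangle$. dSkip: $\mathsf{skip}\mid\mathsf{skip}:\langle\mathcal{R}\rangle\langle\mathcal{R}\rangle$. dSeq: from $c\mid c':\langle\mathcal{R}\rangle\langle\mathcal{S}\rangle$ and $d\mid d':\langle\mathcal{S}\rangle\langle\mathcal{T}\rangle$ infer $c;d\mid c';d':\langle\mathcal{R}\rangle\langle\mathcal{T}\rangle$. dDo: given relations $\mathcal{Q},\Lambda,\mathcal{P}$, from $c\mid\mathsf{skip}:\langle\mathcal{Q}\wedge e^{\mathrm{L}}\wedge\Lambda\rangle\langle\mathcal{Q}\rangle$ for all $e\to c\in gcs$, $\mathsf{skip}\mid c':\langle\mathcal{Q}\wedge e'^{\mathrm{R}}\wedge\mathcal{P}\rangle\langle\mathcal{Q}\rangle$ for all $e'\to c'\in gcs'$, $c\mid c':\langle\mathcal{Q}\wedge e^{\mathrm{L}}\wedge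 e'^{\mathrm{R}}\wedge\neg\Lambda\wedge\neg\mathcal{P}\rangle\langle\mathcal{Q}\rangle$ for all such pairs, and $\mathcal{Q}\Rightarrow(\mathsf{enab}(gcs)^{\mathrm{L}}=\mathsf{enab}(gcs')^{\mathrm{R}})\vee(\Lambda\wedge\mathsf{enab}(gcs)^{\mathrm{L}})\vee(\mathcal{P}\wedge\mathsf{enab}(gcs')^{\mathrm{R}})$, infer $\mathsf{do}\,gcs\,\mathsf{od}\mid\mathsf{do}\,gcs'\,\mathsf{od}:\langle\mathcal{Q}\rangle\langle\mathcal{Q}\wedge\neg\mathsf{enab}(gcs)^{\mathrm{L}}\wedge\neg\mathsf{enab}(gcs')^{\mathrm{R}}\rangle$. rConseq: from $\mathcal{P}\Rightarrow\mathcal{R}$, $c\mid d:\langle\mathcal{R}\rangle\langle\mathcal{S}\rangle$, $\mathcal{S}\Rightarrow\mathcal{Q}$ infer $c\mid d:\langle\mathcal{P}\rangle\langle\mathcal{Q}\rangle$. rDisj: from $c\mid d:\langle\mathcal{Q}\rangle\langle\mathcal{S}\rangle$ and $c\mid d:\langle\mathcal{R}\rangle\langle\mathcal{S}\rangle$ infer $c\mid d:\langle\mathcal{Q}\vee\mathcal{R}\rangle\langle\mathcal{S}\rangle$. rFalse: $c\mid d:\langle\mathrm{false}\rangle\langle\mathcal{R}\rangle$. -}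

module Defs where

open import Level using (Level)
open import Data.Bool using (Bool; true; false; if_then_else_)
open import Data.Nat as ℕ using (ℕ; _≡ᵇ_)
open import Data.Integer as ℤ using (ℤ; _<_; -_; +_)
open import Data.Integer.Properties using () renaming (_≟_ to _≟ℤ_; _<?_ to _<?ℤ_; _≤?_ to _≤?ℤ_)
open import Data.List using (List; []; _∷_; _++_; [_])
open import Data.List.Membership.Propositional using (_∈_; _∉_)
open import Data.List.Membership.Propositional.Properties using (∈-++⁺ˡ)
open import Data.List.Relation.Unary.All using (All)
open import Data.List.Relation.Unary.Any using (here)
open import Data.List.Relation.Unary.Unique.Propositional using (Unique)
open import Data.Product using (Σ; ∃; _×_; _,_; proj₁; proj₂)
open import Data.Sum using (_⊎_; inj₁; inj₂)
open import Data.Unit using (⊤)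
open import Data.Empty using (⊥)
open import Relation.Nullary using (¬_)
open import Relation.Nullary.Decidable using (⌊_⌋)
open import Relation.Binary.PropositionalEquality using (_≡_; _≢_; refl)

Var : Set
Var = ℕ

Store : Set
Store = Var → ℤ

_[_↦_] : Store → Var → ℤ → Store
(s [ x ↦ v ]) y = if x ≡ᵇ y then v else s y

data IExp : Set where
  const : ℤ → IExp
  var   : Var → IExp
  plus minus times : IExp → IExp → IExp

data PrimB : Set where
  eqE ltE leE : IExp → IExp → PrimB

data BExp : Set where
  prim : PrimB → BExp
  _∧E_ _∨E_ : BExp → BExp → BExp
  ¬E_ : BExp → BExp

⟦_⟧i : IExp → Store → ℤ
⟦ const n ⟧i s = n
⟦ var x ⟧i s = s x
⟦ plus a b ⟧i s = ⟦ a ⟧i s ℤ.+ ⟦ b ⟧i s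
⟦ minus a b ⟧i s = ⟦ a ⟧i s ℤ.- ⟦ b ⟧i s
⟦ times a b ⟧i s = ⟦ a ⟧i s ℤ.* ⟦ b ⟧i s

⟦_⟧p : PrimB → Store → Bool
⟦ eqE a b ⟧p s = ⌊ ⟦ a ⟧i s ≟ℤ ⟦ b ⟧i s ⌋
⟦ ltE a b ⟧p s = ⌊ ⟦ a ⟧i s <?ℤ ⟦ b ⟧i s ⌋
⟦ leE a b ⟧p s = ⌊ ⟦ a ⟧i s ≤?ℤ ⟦ b ⟧i s ⌋

⟦_⟧b : BExp → Store → Bool
⟦ prim p ⟧b s = ⟦ p ⟧p s
⟦ a ∧E b ⟧b s = Data.Bool._∧_ (⟦ a ⟧b s) (⟦ b ⟧b s)
⟦ a ∨E b ⟧b s = Data.Bool._∨_ (⟦ a ⟧b s) (⟦ b ⟧b s)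
⟦ ¬E a ⟧b s = Data.Bool.not (⟦ a ⟧b s)

OccI : Var → IExp → Set
OccI x (const _) = ⊥
OccI x (var y) = x ≡ y
OccI x (plus a b) = OccI x a ⊎ OccI x b
OccI x (minus a b) = OccI x a ⊎ OccI x b
OccI x (times a b) = OccI x a ⊎ OccI x b

OccP : Var → PrimB → Set
OccP x (eqE a b) = OccI x a ⊎ OccI x b
OccP x (ltE a b) = OccI x a ⊎ OccI x b
OccP x (leE a b) = OccI x a ⊎ OccI x b

OccB : Var → BExp → Set
OccB x (prim p) = OccP x p
OccB x (a ∧E b) = OccB x a ⊎ OccB x b
OccB x (a ∨E b) = OccB x a ⊎ OccB x b
OccB x (¬E a) = OccB x a

-- GCL commands (labelled); typing is enforced by the syntax

Label : Set
Label = ℤ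

mutual
  data Cmd : Set where
    SKIP : Label → Cmd
    ASGN : Label → Var → IExp → Cmd
    _⨟_  : Cmd → Cmd → Cmd
    IF   : Label → GCs → Cmd
    DO   : Label → GCs → Cmd

  data GCs : Set where
    [_↝_]   : BExp → Cmd → GCs
    _↝_□_ : BExp → Cmd → GCs → GCs

infixr 5 _⨟_

data _∈G_ : BExp × Cmd → GCs → Set where
  here₁ : ∀ {e c} → (e , c) ∈G [ e ↝ c ]
  here₂ : ∀ {e c gs} → (e , c) ∈G (e ↝ c □ gs)
  there : ∀ {ec e c gs} → ec ∈G gs → ec ∈G (e ↝ c □ gs)

enab : GCs → BExp
enab [ e ↝ c ] = e
enab (e ↝ c □ gs) = e ∨E enab gs

mutual
  data WF : Cmd → Set where
    wf-skip : ∀ {n} → WF (SKIP n)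
    wf-asgn : ∀ {n x e} → WF (ASGN n x e)
    wf-seq  : ∀ {c d} → WF c → WF d → WF (c ⨟ d)
    wf-if   : ∀ {n gs} → (∀ s → ⟦ enab gs ⟧b s ≡ true) → WFG gs → WF (IF n gs)
    wf-do   : ∀ {n gs} → WFG gs → WF (DO n gs)

  data WFG : GCs → Set where
    wfg-one  : ∀ {e c} → WF c → WFG [ e ↝ c ]
    wfg-cons : ∀ {e c gs} → WF c → WFG gs → WFG (e ↝ c □ gs)

lab : Cmd → Label
lab (SKIP n) = n
lab (ASGN n _ _) = n
lab (c ⨟ d) = lab c
lab (IF n _) = n
lab (DO n _) = n

mutual
  labs : Cmd → List Label
  labs (SKIP n) = [ n ]
  labs (ASGN n _ _) = [ n ]
  labs (c ⨟ d) = labs c ++ labs d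
  labs (IF n gs) = n ∷ labsG gs
  labs (DO n gs) = n ∷ labsG gs

  labsG : GCs → List Label
  labsG [ e ↝ c ] = labs c
  labsG (e ↝ c □ gs) = labs c ++ labsG gs

lab∈labs : ∀ c → lab c ∈ labs c
lab∈labs (SKIP n) = here refl
lab∈labs (ASGN n _ _) = here refl
lab∈labs (c ⨟ d) = ∈-++⁺ˡ (lab∈labs c)
lab∈labs (IF n _) = here refl
lab∈labs (DO n _) = here refl

ok : Cmd → Set
ok c = All (λ n → + 0 < n) (labs c) × Unique (labs c)

okf : Cmd → Label → Set
okf c f = ok c × f ∉ labs c

-- sub(n,c) d : d is the (non-sequence) subcommand of c labelled n
data Sub (n : Label) : Cmd → Cmd → Set where
  sub-skip : Sub n (SKIP n) (SKIP n)
  sub-asgn : ∀ {x e} → Sub n (ASGN n x e) (ASGN n x e)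
  sub-if   : ∀ {gs} → Sub n (IF n gs) (IF n gs)
  sub-do   : ∀ {gs} → Sub n (DO n gs) (DO n gs)
  sub-seqˡ : ∀ {c d b} → Sub n c b → Sub n (c ⨟ d) b
  sub-seqʳ : ∀ {c d b} → Sub n d b → Sub n (c ⨟ d) b
  sub-inif : ∀ {m gs e d b} → (e , d) ∈G gs → Sub n d b → Sub n (IF m gs) b
  sub-indo : ∀ {m gs e d b} → (e , d) ∈G gs → Sub n d b → Sub n (DO m gs) b

-- fsuc(n,c,f) = m, as a relation following the defining equations
data FSuc : Label → Cmd → Label → Label → Set where
  fs-skip : ∀ {n f} → FSuc n (SKIP n) f f
  fs-asgn : ∀ {n x e f} → FSuc n (ASGN n x e) f f
  fs-if   : ∀ {n gs f} → FSuc n (IF n gs) f f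
  fs-do   : ∀ {n gs f} → FSuc n (DO n gs) f f
  fs-seqˡ : ∀ {n c d f m} → n ∈ labs c → FSuc n c (lab d) m → FSuc n (c ⨟ d) f m
  fs-seqʳ : ∀ {n c d f m} → n ∉ labs c → FSuc n d f m → FSuc n (c ⨟ d) f m
  fs-inif : ∀ {m n gs e d f k} → m ≢ n → (e , d) ∈G gs → m ∈ labs d →
            FSuc m d f k → FSuc m (IF n gs) f k
  fs-indo : ∀ {m n gs e d f k} → m ≢ n → (e , d) ∈G gs → m ∈ labs d →
            FSuc m d n k → FSuc m (DO n gs) f k

data Step : Cmd → Store → Cmd → Store → Set where
  st-if     : ∀ {n gs e d s} → (e , d) ∈G gs → ⟦ e ⟧b s ≡ true →
              Step (IF n gs) s d s
  st-do     : ∀ {n gs e d s} → (e , d) ∈G gs → ⟦ e ⟧b s ≡ true →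
              Step (DO n gs) s (d ⨟ DO n gs) s
  st-doexit : ∀ {n gs s} → ⟦ enab gs ⟧b s ≡ false →
              Step (DO n gs) s (SKIP (- n)) s
  st-asgn   : ∀ {n x e s} → Step (ASGN n x e) s (SKIP (- n)) (s [ x ↦ ⟦ e ⟧i s ])
  st-skip   : ∀ {n c s} → Step (SKIP n ⨟ c) s c s
  st-seq    : ∀ {c s d t b} → Step c s d t → Step (c ⨟ b) s (d ⨟ b) t

record Automaton : Set₁ where
  field
    Ctrl : Set
    Sto  : Set
    init : Ctrl
    fin  : Ctrl
    _⇒_  : Ctrl × Sto → Ctrl × Sto → Set

open Automaton public

record CP (c : Cmd) (f : Label) : Set where
  constructor cp
  field
    pt    : Label
    .isPt : pt ∈ labs c ⊎ pt ≡ f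

open CP public

data AutStep (c : Cmd) (f : Label) : Label → Store → Label → Store → Set where
  as-pos  : ∀ {n s m t b d} → Sub n c b → Step b s d t → + 0 < lab d → m ≡ lab d →
            AutStep c f n s m t
  as-neg  : ∀ {n s m t b d} → Sub n c b → Step b s d t → lab d < + 0 → FSuc n c f m →
            AutStep c f n s m t
  as-skip : ∀ {n s m} → Sub n c (SKIP n) → FSuc n c f m → AutStep c f n s m s

aut : Cmd → Label → Automaton
aut c f = record
  { Ctrl = CP c f
  ; Sto  = Store
  ; init = cp (lab c) (inj₁ (lab∈labs c))
  ; fin  = cp f (inj₂ refl)
  ; _⇒_  = λ { (p , s) (q , t) → AutStep c f (pt p) s (pt q) t }
  }

Cond : Automaton → Automaton → Set₁
Cond A A' = (Ctrl A × Ctrl A') × (Sto A × Sto A') → Set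

∏ : (A A' : Automaton) → (L R J : Cond A A') → Automaton
∏ A A' L R J = record
  { Ctrl = Ctrl A × Ctrl A'
  ; Sto  = Sto A × Sto A'
  ; init = init A , init A'
  ; fin  = fin A , fin A'
  ; _⇒_  = λ { ((n , n') , (s , s')) ((m , m') , (t , t')) →
               (L ((n , n') , (s , s')) × (_⇒_ A) (n , s) (m , t) × (n' , s') ≡ (m' , t'))
             ⊎ (R ((n , n') , (s , s')) × (n , s) ≡ (m , t) × (_⇒_ A') (n' , s') (m' , t'))
             ⊎ (J ((n , n') , (s , s')) × (_⇒_ A) (n , s) (m , t) × (_⇒_ A') (n' , s') (m' , t')) }
  }

Live : (A A' : Automaton) → (L R J : Cond A A') → Set
Live A A' L R J =
    (∀ n n' s s' → L ((n , n') , (s , s')) → ∃ λ mt → (_⇒_ A) (n , s) mt)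
  × (∀ n n' s s' → R ((n , n') , (s , s')) → ∃ λ mt → (_⇒_ A') (n' , s') mt)
  × (∀ n n' s s' → J ((n , n') , (s , s')) →
       (∃ λ mt → (_⇒_ A) (n , s) mt) × (∃ λ mt → (_⇒_ A') (n' , s') mt))

[_∣_] : {A A' : Automaton} → Ctrl A → Ctrl A' → Cond A A'
[ n ∣ n' ] ((k , k') , _) = k ≡ n × k' ≡ n'

_∪_ : {X : Set} → (X → Set) → (X → Set) → X → Set
(P ∪ Q) x = P x ⊎ Q x

_⊆_ : {X : Set} → (X → Set) → (X → Set) → Set
P ⊆ Q = ∀ x → P x → Q x

infixr 5 _∪_

IsAnnotation : (A : Automaton) → (Ctrl A → Sto A → Set) → (Sto A → Set) → (Sto A → Set) → Set
IsAnnotation A an P Q = (an (init A) ⊆ P × P ⊆ an (init A)) × (an (fin A) ⊆ Q × Q ⊆ an (fin A))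

ValidAnnotation : (A : Automaton) → (Ctrl A → Sto A → Set) → Set
ValidAnnotation A an = ∀ n m s t → an n s → (_⇒_ A) (n , s) (m , t) → an m t

lift : (A A' : Automaton) → (Ctrl A × Ctrl A' → Sto A × Sto A' → Set) →
       Ctrl A × Ctrl A' → Cond A A'
lift A A' an ij (kk , ss) = kk ≡ ij × an ij ss

Rel₂ : Set₁
Rel₂ = Store × Store → Set

_⇛_ : Rel₂ → Rel₂ → Set
P ⇛ Q = ∀ p → P p → Q p

_∧R_ _∨R_ : Rel₂ → Rel₂ → Rel₂
(P ∧R Q) p = P p × Q p
(P ∨R Q) p = P p ⊎ Q p

¬R_ : Rel₂ → Rel₂
(¬R P) p = ¬ P p

falseR : Rel₂
falseR _ = ⊥

infixr 6 _∧R_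
infixr 5 _∨R_

_ᴸ _ᴿ : BExp → Rel₂
(e ᴸ) (s , s') = ⟦ e ⟧b s ≡ true
(e ᴿ) (s , s') = ⟦ e ⟧b s' ≡ true

_ᴸ≐_ᴿ : BExp → BExp → Rel₂
(e ᴸ≐ e' ᴿ) (s , s') = ⟦ e ⟧b s ≡ ⟦ e' ⟧b s'

subst₂ : Rel₂ → Var → Var → IExp → IExp → Rel₂
subst₂ R x x' e e' (s , s') = R (s [ x ↦ ⟦ e ⟧i s ] , s' [ x' ↦ ⟦ e' ⟧i s' ])

substL : Rel₂ → Var → IExp → Rel₂
substL R x e (s , s') = R (s [ x ↦ ⟦ e ⟧i s ] , s')

substR : Rel₂ → Var → IExp → Rel₂
substR R x e (s , s') = R (s , s' [ x ↦ ⟦ e ⟧i s' ])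

indep : Var → Var → Rel₂ → Set
indep x x' R = ∀ s s' v v' →
  (R (s , s') → R (s [ x ↦ v ] , s' [ x' ↦ v' ])) ×
  (R (s [ x ↦ v ] , s' [ x' ↦ v' ]) → R (s , s'))

mutual
  ghost : Var → Cmd → Set
  ghost x (SKIP _) = ⊤
  ghost x (ASGN _ y e) = x ≡ y ⊎ ¬ OccI x e
  ghost x (c ⨟ d) = ghost x c × ghost x d
  ghost x (IF _ gs) = ghostG x gs
  ghost x (DO _ gs) = ghostG x gs

  ghostG : Var → GCs → Set
  ghostG x [ e ↝ c ] = ¬ OccB x e × ghost x c
  ghostG x (e ↝ c □ gs) = ¬ OccB x e × ghost x c × ghostG x gs

mutual
  erase : Var → Cmd → Cmd
  erase x (SKIP n) = SKIP n
  erase x (ASGN n y e) = if x ≡ᵇ y then SKIP n else ASGN n y e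
  erase x (c ⨟ d) = erase x c ⨟ erase x d
  erase x (IF n gs) = IF n (eraseG x gs)
  erase x (DO n gs) = DO n (eraseG x gs)

  eraseG : Var → GCs → GCs
  eraseG x [ e ↝ c ] = [ e ↝ erase x c ]
  eraseG x (e ↝ c □ gs) = e ↝ erase x c □ eraseG x gs

data Test : Set where
  tprim : PrimB → Test
  𝟘 𝟙   : Test
  _·_ _+_ : Test → Test → Test
  ∼_    : Test → Test

data Kat : Set where
  tst  : Test → Kat
  act  : Var → IExp → Kat
  _⨾_ _⊕_ : Kat → Kat → Kat
  _⋆   : Kat → Kat

infixl 7 _·_ _⨾_
infixl 6 _+_ _⊕_

Kb : BExp → Test
Kb (prim p) = tprim p
Kb (a ∧E b) = Kb a · Kb b
Kb (a ∨E b) = Kb a + Kb b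
Kb (¬E a) = ∼ Kb a

mutual
  Kc : Cmd → Kat
  Kc (SKIP _) = tst 𝟙
  Kc (ASGN _ x e) = act x e
  Kc (c ⨟ d) = Kc c ⨾ Kc d
  Kc (IF _ gs) = Kg gs
  Kc (DO _ gs) = (Kg gs ⋆) ⨾ tst (∼ Kb (enab gs))

  Kg : GCs → Kat
  Kg [ e ↝ c ] = tst (Kb e) ⨾ Kc c
  Kg (e ↝ c □ gs) = (tst (Kb e) ⨾ Kc c) ⊕ Kg gs

-- Boolean algebra on tests (bounded commutative idempotent semiring with
-- top 1 and complements), plus the first kind of hypothesis
data _≈t_ : Test → Test → Set where
  t-refl  : ∀ {a} → a ≈t a
  t-sym   : ∀ {a b} → a ≈t b → b ≈t a
  t-trans : ∀ {a b c} → a ≈t b → b ≈t c → a ≈t c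
  t-cong· : ∀ {a a' b b'} → a ≈t a' → b ≈t b' → (a · b) ≈t (a' · b')
  t-cong+ : ∀ {a a' b b'} → a ≈t a' → b ≈t b' → (a + b) ≈t (a' + b')
  t-cong∼ : ∀ {a a'} → a ≈t a' → (∼ a) ≈t (∼ a')
  t+assoc : ∀ {a b c} → ((a + b) + c) ≈t (a + (b + c))
  t+comm  : ∀ {a b} → (a + b) ≈t (b + a)
  t+zero  : ∀ {a} → (a + 𝟘) ≈t a
  t+idem  : ∀ {a} → (a + a) ≈t a
  t·assoc : ∀ {a b c} → ((a · b) · c) ≈t (a · (b · c))
  t·comm  : ∀ {a b} → (a · b) ≈t (b · a)
  t·one   : ∀ {a} → (𝟙 · a) ≈t a
  t·zero  : ∀ {a} → (𝟘 · a) ≈t 𝟘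
  t·idem  : ∀ {a} → (a · a) ≈t a
  t-distr : ∀ {a b c} → (a · (b + c)) ≈t ((a · b) + (a · c))
  t-top   : ∀ {a} → (a + 𝟙) ≈t 𝟙
  t-compl+ : ∀ {a} → (a + ∼ a) ≈t 𝟙
  t-compl· : ∀ {a} → (a · ∼ a) ≈t 𝟘
  t-hyp   : ∀ {e} → (∀ s → ⟦ e ⟧b s ≡ false) → Kb e ≈t 𝟘

data _≈k_ : Kat → Kat → Set where
  k-refl  : ∀ {p} → p ≈k p
  k-sym   : ∀ {p q} → p ≈k q → q ≈k p
  k-trans : ∀ {p q r} → p ≈k q → q ≈k r → p ≈k r
  k-cong⨾ : ∀ {p p' q q'} → p ≈k p' → q ≈k q' → (p ⨾ q) ≈k (p' ⨾ q')
  k-cong⊕ : ∀ {p p' q q'} → p ≈k p' → q ≈k q' → (p ⊕ q) ≈k (p' ⊕ q')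
  k-cong⋆ : ∀ {p p'} → p ≈k p' → (p ⋆) ≈k (p' ⋆)
  k-test  : ∀ {a b} → a ≈t b → tst a ≈k tst b
  k-test· : ∀ {a b} → tst (a · b) ≈k (tst a ⨾ tst b)
  k-test+ : ∀ {a b} → tst (a + b) ≈k (tst a ⊕ tst b)
  k⊕assoc : ∀ {p q r} → ((p ⊕ q) ⊕ r) ≈k (p ⊕ (q ⊕ r))
  k⊕comm  : ∀ {p q} → (p ⊕ q) ≈k (q ⊕ p)
  k⊕zero  : ∀ {p} → (p ⊕ tst 𝟘) ≈k p
  k⊕idem  : ∀ {p} → (p ⊕ p) ≈k p
  k⨾assoc : ∀ {p q r} → ((p ⨾ q) ⨾ r) ≈k (p ⨾ (q ⨾ r))
  k⨾oneˡ  : ∀ {p} → (tst 𝟙 ⨾ p) ≈k p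
  k⨾oneʳ  : ∀ {p} → (p ⨾ tst 𝟙) ≈k p
  k⨾zeroˡ : ∀ {p} → (tst 𝟘 ⨾ p) ≈k tst 𝟘
  k⨾zeroʳ : ∀ {p} → (p ⨾ tst 𝟘) ≈k tst 𝟘
  k-distˡ : ∀ {p q r} → (p ⨾ (q ⊕ r)) ≈k ((p ⨾ q) ⊕ (p ⨾ r))
  k-distʳ : ∀ {p q r} → ((p ⊕ q) ⨾ r) ≈k ((p ⨾ r) ⊕ (q ⨾ r))
  k-unfoldˡ : ∀ {p} → (tst 𝟙 ⊕ (p ⨾ (p ⋆))) ≈k (p ⋆)
  k-unfoldʳ : ∀ {p} → (tst 𝟙 ⊕ ((p ⋆) ⨾ p)) ≈k (p ⋆)
  -- x ≤ y  iff  x + y = y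
  k-indˡ  : ∀ {x y z} → ((y ⊕ (x ⨾ z)) ⊕ z) ≈k z → (((x ⋆) ⨾ y) ⊕ z) ≈k z
  k-indʳ  : ∀ {x y z} → ((y ⊕ (z ⨾ x)) ⊕ z) ≈k z → ((y ⨾ (x ⋆)) ⊕ z) ≈k z
  -- second kind of hypothesis: e0 ⇒ e1[x:=e] valid
  k-hyp   : ∀ {e₀ e₁ x e} →
            (∀ s → ⟦ e₀ ⟧b s ≡ true → ⟦ e₁ ⟧b (s [ x ↦ ⟦ e ⟧i s ]) ≡ true) →
            ((tst (Kb e₀) ⨾ act x e) ⨾ tst (∼ Kb e₁)) ≈k tst 𝟘

_≅_ : Cmd → Cmd → Set
c ≅ d = Kc c ≈k Kc d

data ⊢_∣_∶⟨_⟩⟨_⟩ : Cmd → Cmd → Rel₂ → Rel₂ → Set₁ where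
  rRewrite : ∀ {c c' d d' R S} → ⊢ c ∣ c' ∶⟨ R ⟩⟨ S ⟩ → c ≅ d → c' ≅ d' →
             ⊢ d ∣ d' ∶⟨ R ⟩⟨ S ⟩
  rGhost   : ∀ {c c' x x' R S} → ⊢ c ∣ c' ∶⟨ R ⟩⟨ S ⟩ → ghost x c → ghost x' c' →
             indep x x' R → indep x x' S →
             ⊢ erase x c ∣ erase x' c' ∶⟨ R ⟩⟨ S ⟩
  dIf      : ∀ {n n' gs gs' R S} →
             (∀ {e c e' c'} → (e , c) ∈G gs → (e' , c') ∈G gs' →
                ⊢ c ∣ c' ∶⟨ R ∧R (e ᴸ) ∧R (e' ᴿ) ⟩⟨ S ⟩) →
             ⊢ IF n gs ∣ IF n' gs' ∶⟨ R ⟩⟨ S ⟩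
  dAsgn    : ∀ {n n' x x' e e' R} →
             ⊢ ASGN n x e ∣ ASGN n' x' e' ∶⟨ subst₂ R x x' e e' ⟩⟨ R ⟩
  AsgnSkip : ∀ {n n' x e R} → ⊢ ASGN n x e ∣ SKIP n' ∶⟨ substL R x e ⟩⟨ R ⟩
  SkipAsgn : ∀ {n n' x e R} → ⊢ SKIP n ∣ ASGN n' x e ∶⟨ substR R x e ⟩⟨ R ⟩
  dSkip    : ∀ {n n' R} → ⊢ SKIP n ∣ SKIP n' ∶⟨ R ⟩⟨ R ⟩
  dSeq     : ∀ {c c' d d' R S T} → ⊢ c ∣ c' ∶⟨ R ⟩⟨ S ⟩ → ⊢ d ∣ d' ∶⟨ S ⟩⟨ T ⟩ →
             ⊢ c ⨟ d ∣ c' ⨟ d' ∶⟨ R ⟩⟨ T ⟩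
  dDo      : ∀ {n n' k k' gs gs'} (Q Λ P : Rel₂) →
             (∀ {e c} → (e , c) ∈G gs →
                ⊢ c ∣ SKIP k ∶⟨ Q ∧R (e ᴸ) ∧R Λ ⟩⟨ Q ⟩) →
             (∀ {e' c'} → (e' , c') ∈G gs' →
                ⊢ SKIP k' ∣ c' ∶⟨ Q ∧R (e' ᴿ) ∧R P ⟩⟨ Q ⟩) →
             (∀ {e c e' c'} → (e , c) ∈G gs → (e' , c') ∈G gs' →
                ⊢ c ∣ c' ∶⟨ Q ∧R (e ᴸ) ∧R (e' ᴿ) ∧R (¬R Λ) ∧R (¬R P) ⟩⟨ Q ⟩) →
             Q ⇛ ((enab gs ᴸ≐ enab gs' ᴿ) ∨R (Λ ∧R (enab gs ᴸ)) ∨R (P ∧R (enab gs' ᴿ))) →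
             ⊢ DO n gs ∣ DO n' gs' ∶⟨ Q ⟩⟨ Q ∧R (¬R (enab gs ᴸ)) ∧R (¬R (enab gs' ᴿ)) ⟩
  rConseq  : ∀ {c d P R S Q} → P ⇛ R → ⊢ c ∣ d ∶⟨ R ⟩⟨ S ⟩ → S ⇛ Q →
             ⊢ c ∣ d ∶⟨ P ⟩⟨ Q ⟩
  rDisj    : ∀ {c d Q R S} → ⊢ c ∣ d ∶⟨ Q ⟩⟨ S ⟩ → ⊢ c ∣ d ∶⟨ R ⟩⟨ S ⟩ →
             ⊢ c ∣ d ∶⟨ Q ∨R R ⟩⟨ S ⟩
  rFalse   : ∀ {c d R} → ⊢ c ∣ d ∶⟨ falseR ⟩⟨ R ⟩

{-# OPTIONS --safe #-}
module Submission where

-- The annotation of the alignment automaton propagates along any pair of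
-- terminating runs of the two component automata: the coverage condition says
-- that at every annotated state some alignment condition applies (or both sides
-- have finished), liveness lets the runs be advanced accordingly, and validity
-- transfers the annotation; since final control points have no successors, both
-- runs are used up exactly when the final pair is reached.  A big-step execution
-- of c gives such a run of aut(c,f), so c | c' : <S><T> is semantically valid.
-- Derivability then follows from relative completeness of RHL+ for semantic
-- assertions: c ; skip | skip ; c' is derived through the one-sided weakest
-- preconditions, with skip disguised as a trivial if or do (equal to skip in
-- KAT) whenever dIf or dDo needs a partner command.

open import Defs
open import Data.Integer using (ℤ)
open import Data.Product using (_×_; _,_)

open import Data.Bool using (true; false)
open import Data.Bool.Properties using (¬-not)
open import Data.Integer using (+_; _<_)
open import Data.Integer.Properties using (neg-mono-<)
open import Data.List using (List; []; _∷_; _++_)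
open import Data.List.Membership.Propositional using (_∈_)
open import Data.List.Membership.Propositional.Properties using (∈-++⁺ˡ; ∈-++⁺ʳ)
open import Data.List.Relation.Binary.Disjoint.Propositional using (Disjoint)
import Data.List.Relation.Unary.All as All
import Data.List.Relation.Unary.All.Properties as All
open import Data.List.Relation.Unary.AllPairs using ([]; _∷_)
open import Data.List.Relation.Unary.Any using (here; there)
open import Data.List.Relation.Unary.Unique.Propositional using (Unique)
open import Data.List.Relation.Unary.Unique.Propositional.Properties
  using (Unique[x∷xs]⇒x∉xs)
open import Data.Product using (proj₁; proj₂)
open import Data.Sum using (_⊎_; inj₁; inj₂)
open import Data.Unit using (⊤; tt)
open import Data.Empty using (⊥-elim)
open import Function using (id)
open import Relation.Nullary using (¬_)
open import Relation.Binary.Construct.Closure.ReflexiveTransitive using (Star; ε; _◅_; _◅◅_)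
open import Relation.Binary.PropositionalEquality using (_≡_; _≢_; refl)

Unique-++⁻ˡ : ∀ {A : Set} (xs : List A) {ys} → Unique (xs ++ ys) → Unique xs
Unique-++⁻ˡ []       _          = []
Unique-++⁻ˡ (x ∷ xs) (x∉ ∷ xs!) = All.++⁻ˡ xs x∉ ∷ Unique-++⁻ˡ xs xs!

Unique-++⁻ʳ : ∀ {A : Set} (xs : List A) {ys} → Unique (xs ++ ys) → Unique ys
Unique-++⁻ʳ []       ys!       = ys!
Unique-++⁻ʳ (x ∷ xs) (_ ∷ xs!) = Unique-++⁻ʳ xs xs!

Unique-++⇒Disjoint : ∀ {A : Set} (xs : List A) {ys} → Unique (xs ++ ys) → Disjoint xs ys
Unique-++⇒Disjoint (x ∷ xs) (x∉ ∷ _)   (here refl , v∈ys) = All.lookup (All.++⁻ʳ xs x∉) v∈ys refl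
Unique-++⇒Disjoint (x ∷ xs) (_ ∷ xs!) (there v∈xs , v∈ys) = Unique-++⇒Disjoint xs xs! (v∈xs , v∈ys)

data ⟨_,_⟩⇓_ : Cmd → Store → Store → Set where
  ⇓skip : ∀ {n s} → ⟨ SKIP n , s ⟩⇓ s
  ⇓asgn : ∀ {n x e s} → ⟨ ASGN n x e , s ⟩⇓ (s [ x ↦ ⟦ e ⟧i s ])
  ⇓seq  : ∀ {c d s u t} → ⟨ c , s ⟩⇓ u → ⟨ d , u ⟩⇓ t → ⟨ c ⨟ d , s ⟩⇓ t
  ⇓if   : ∀ {n gs e d s t} → (e , d) ∈G gs → ⟦ e ⟧b s ≡ true → ⟨ d , s ⟩⇓ t →
          ⟨ IF n gs , s ⟩⇓ t
  ⇓loop : ∀ {n gs e d s u t} → (e , d) ∈G gs → ⟦ e ⟧b s ≡ true → ⟨ d , s ⟩⇓ u →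
          ⟨ DO n gs , u ⟩⇓ t → ⟨ DO n gs , s ⟩⇓ t
  ⇓done : ∀ {n gs s} → ⟦ enab gs ⟧b s ≡ false → ⟨ DO n gs , s ⟩⇓ s

⊨_∣_∶⟨_⟩⟨_⟩ : Cmd → Cmd → Rel₂ → Rel₂ → Set
⊨ c ∣ c' ∶⟨ R ⟩⟨ S ⟩ =
  ∀ {s s' t t'} → ⟨ c , s ⟩⇓ t → ⟨ c' , s' ⟩⇓ t' → R (s , s') → S (t , t')

wpˡ wpʳ : Cmd → Rel₂ → Rel₂
wpˡ c X (s , s') = ∀ t → ⟨ c , s ⟩⇓ t → X (t , s')
wpʳ c X (s , s') = ∀ t' → ⟨ c , s' ⟩⇓ t' → X (s , t')

0≐0 : PrimB
0≐0 = eqE (const (+ 0)) (const (+ 0))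

true₀ false₀ : BExp
true₀  = prim 0≐0 ∨E (¬E prim 0≐0)
false₀ = prim 0≐0 ∧E (¬E prim 0≐0)

trueR : Rel₂
trueR _ = ⊤

skip⨟skip≅skip : ∀ k → (SKIP k ⨟ SKIP k) ≅ SKIP k
skip⨟skip≅skip k = k⨾oneˡ

if-true-skip≅skip : ∀ k → IF k [ true₀ ↝ SKIP k ] ≅ SKIP k
if-true-skip≅skip k = k-trans k⨾oneʳ (k-test t-compl+)

do-false-skip≅skip : ∀ k → DO k [ false₀ ↝ SKIP k ] ≅ SKIP k
do-false-skip≅skip k = k-trans (k-cong⨾ body⋆≈1 (k-test ∼false₀≈1)) k⨾oneʳ
  where
  body≈0 : (tst (Kb false₀) ⨾ tst 𝟙) ≈k tst 𝟘
  body≈0 = k-trans (k-cong⨾ (k-test t-compl·) k-refl) k⨾zeroˡ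
  body⋆≈1 : ((tst (Kb false₀) ⨾ tst 𝟙) ⋆) ≈k tst 𝟙
  body⋆≈1 = k-trans (k-cong⋆ body≈0)
              (k-trans (k-sym k-unfoldˡ) (k-trans (k-cong⊕ k-refl k⨾zeroˡ) k⊕zero))
  ∼false₀≈1 : (∼ Kb false₀) ≈t 𝟙
  ∼false₀≈1 = t-trans (t-cong∼ t-compl·) (t-trans (t-sym t+zero) (t-trans t+comm t-compl+))

mutual
  ⊢-wpˡ : ∀ c k X → ⊢ c ∣ SKIP k ∶⟨ wpˡ c X ⟩⟨ X ⟩
  ⊢-wpˡ (SKIP n) k X = rConseq (λ _ w → w _ ⇓skip) dSkip (λ _ → id)
  ⊢-wpˡ (ASGN n x e) k X = rConseq (λ _ w → w _ ⇓asgn) AsgnSkip (λ _ → id)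
  ⊢-wpˡ (c ⨟ d) k X =
    rRewrite (rConseq (λ _ w u ⇓c t ⇓d → w t (⇓seq ⇓c ⇓d))
                      (dSeq (⊢-wpˡ c k (wpˡ d X)) (⊢-wpˡ d k X)) (λ _ → id))
             k-refl (skip⨟skip≅skip k)
  ⊢-wpˡ (IF n gs) k X = rRewrite (dIf {n = n} {n' = k} branch) k-refl (if-true-skip≅skip k)
    where
    branch : ∀ {e c e' c'} → (e , c) ∈G gs → (e' , c') ∈G [ true₀ ↝ SKIP k ] →
             ⊢ c ∣ c' ∶⟨ wpˡ (IF n gs) X ∧R (e ᴸ) ∧R (e' ᴿ) ⟩⟨ X ⟩
    branch ∈gs here₁ =
      rConseq (λ _ (w , e , _) t ⇓d → w t (⇓if ∈gs e ⇓d)) (⊢-wpˡ-∈G ∈gs k X) (λ _ → id)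
  -- The partner loop is never enabled, and Λ = true makes every iteration a left-only step.
  ⊢-wpˡ (DO n gs) k X =
    rRewrite (rConseq (λ _ → id)
                      (dDo {n = n} {n' = k} Inv trueR falseR body skipBody bothBodies enabled) exit)
             k-refl (do-false-skip≅skip k)
    where
    Inv : Rel₂
    Inv = wpˡ (DO n gs) X
    body : ∀ {e c} → (e , c) ∈G gs → ⊢ c ∣ SKIP k ∶⟨ Inv ∧R (e ᴸ) ∧R trueR ⟩⟨ Inv ⟩
    body ∈gs =
      rConseq (λ _ (w , e , _) u ⇓d t ⇓do → w t (⇓loop ∈gs e ⇓d ⇓do)) (⊢-wpˡ-∈G ∈gs k Inv) (λ _ → id)
    skipBody : ∀ {e' c'} → (e' , c') ∈G [ false₀ ↝ SKIP k ] →
               ⊢ SKIP k ∣ c' ∶⟨ Inv ∧R (e' ᴿ) ∧R falseR ⟩⟨ Inv ⟩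
    skipBody here₁ = rConseq (λ { _ (_ , _ , ()) }) rFalse (λ _ → id)
    bothBodies : ∀ {e c e' c'} → (e , c) ∈G gs → (e' , c') ∈G [ false₀ ↝ SKIP k ] →
                 ⊢ c ∣ c' ∶⟨ Inv ∧R (e ᴸ) ∧R (e' ᴿ) ∧R (¬R trueR) ∧R (¬R falseR) ⟩⟨ Inv ⟩
    bothBodies _ here₁ = rConseq (λ _ (_ , _ , _ , ¬⊤ , _) → ¬⊤ tt) rFalse (λ _ → id)
    enabled : Inv ⇛ ((enab gs ᴸ≐ false₀ ᴿ) ∨R (trueR ∧R (enab gs ᴸ)) ∨R (falseR ∧R (false₀ ᴿ)))
    enabled (s , _) _ with ⟦ enab gs ⟧b s
    ... | true  = inj₂ (inj₁ (tt , refl))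
    ... | false = inj₁ refl
    exit : (Inv ∧R (¬R (enab gs ᴸ)) ∧R (¬R (false₀ ᴿ))) ⇛ X
    exit (s , _) (w , disabled , _) = w s (⇓done (¬-not disabled))

  ⊢-wpˡ-∈G : ∀ {gs e d} → (e , d) ∈G gs → ∀ k X → ⊢ d ∣ SKIP k ∶⟨ wpˡ d X ⟩⟨ X ⟩
  ⊢-wpˡ-∈G {[ _ ↝ c ]}   here₁        = ⊢-wpˡ c
  ⊢-wpˡ-∈G {_ ↝ c □ _}   here₂        = ⊢-wpˡ c
  ⊢-wpˡ-∈G               (there ∈gs)  = ⊢-wpˡ-∈G ∈gs

mutual
  ⊢-wpʳ : ∀ c k X → ⊢ SKIP k ∣ c ∶⟨ wpʳ c X ⟩⟨ X ⟩
  ⊢-wpʳ (SKIP n) k X = rConseq (λ _ w → w _ ⇓skip) dSkip (λ _ → id)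
  ⊢-wpʳ (ASGN n x e) k X = rConseq (λ _ w → w _ ⇓asgn) SkipAsgn (λ _ → id)
  ⊢-wpʳ (c ⨟ d) k X =
    rRewrite (rConseq (λ _ w u ⇓c t ⇓d → w t (⇓seq ⇓c ⇓d))
                      (dSeq (⊢-wpʳ c k (wpʳ d X)) (⊢-wpʳ d k X)) (λ _ → id))
             (skip⨟skip≅skip k) k-refl
  ⊢-wpʳ (IF n gs) k X = rRewrite (dIf {n = k} {n' = n} branch) (if-true-skip≅skip k) k-refl
    where
    branch : ∀ {e c e' c'} → (e , c) ∈G [ true₀ ↝ SKIP k ] → (e' , c') ∈G gs →
             ⊢ c ∣ c' ∶⟨ wpʳ (IF n gs) X ∧R (e ᴸ) ∧R (e' ᴿ) ⟩⟨ X ⟩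
    branch here₁ ∈gs =
      rConseq (λ _ (w , _ , e) t ⇓d → w t (⇓if ∈gs e ⇓d)) (⊢-wpʳ-∈G ∈gs k X) (λ _ → id)
  ⊢-wpʳ (DO n gs) k X =
    rRewrite (rConseq (λ _ → id)
                      (dDo {n = k} {n' = n} Inv falseR trueR skipBody body bothBodies enabled) exit)
             (do-false-skip≅skip k) k-refl
    where
    Inv : Rel₂
    Inv = wpʳ (DO n gs) X
    skipBody : ∀ {e c} → (e , c) ∈G [ false₀ ↝ SKIP k ] →
               ⊢ c ∣ SKIP k ∶⟨ Inv ∧R (e ᴸ) ∧R falseR ⟩⟨ Inv ⟩
    skipBody here₁ = rConseq (λ { _ (_ , _ , ()) }) rFalse (λ _ → id)
    body : ∀ {e' c'} → (e' , c') ∈G gs → ⊢ SKIP k ∣ c' ∶⟨ Inv ∧R (e' ᴿ) ∧R trueR ⟩⟨ Inv ⟩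
    body ∈gs =
      rConseq (λ _ (w , e , _) u ⇓d t ⇓do → w t (⇓loop ∈gs e ⇓d ⇓do)) (⊢-wpʳ-∈G ∈gs k Inv) (λ _ → id)
    bothBodies : ∀ {e c e' c'} → (e , c) ∈G [ false₀ ↝ SKIP k ] → (e' , c') ∈G gs →
                 ⊢ c ∣ c' ∶⟨ Inv ∧R (e ᴸ) ∧R (e' ᴿ) ∧R (¬R falseR) ∧R (¬R trueR) ⟩⟨ Inv ⟩
    bothBodies here₁ _ = rConseq (λ _ (_ , _ , _ , _ , ¬⊤) → ¬⊤ tt) rFalse (λ _ → id)
    enabled : Inv ⇛ ((false₀ ᴸ≐ enab gs ᴿ) ∨R (falseR ∧R (false₀ ᴸ)) ∨R (trueR ∧R (enab gs ᴿ)))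
    enabled (_ , s') _ with ⟦ enab gs ⟧b s'
    ... | true  = inj₂ (inj₂ (tt , refl))
    ... | false = inj₁ refl
    exit : (Inv ∧R (¬R (false₀ ᴸ)) ∧R (¬R (enab gs ᴿ))) ⇛ X
    exit (_ , s') (w , _ , disabled) = w s' (⇓done (¬-not disabled))

  ⊢-wpʳ-∈G : ∀ {gs e d} → (e , d) ∈G gs → ∀ k X → ⊢ SKIP k ∣ d ∶⟨ wpʳ d X ⟩⟨ X ⟩
  ⊢-wpʳ-∈G {[ _ ↝ c ]}   here₁        = ⊢-wpʳ c
  ⊢-wpʳ-∈G {_ ↝ c □ _}   here₂        = ⊢-wpʳ c
  ⊢-wpʳ-∈G               (there ∈gs)  = ⊢-wpʳ-∈G ∈gs

completeness : ∀ {c c' S T} → ⊨ c ∣ c' ∶⟨ S ⟩⟨ T ⟩ → ⊢ c ∣ c' ∶⟨ S ⟩⟨ T ⟩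
completeness {c} {c'} {S} {T} ⊨cc' =
  rRewrite (rConseq pre (dSeq (⊢-wpˡ c k (wpʳ c' T)) (⊢-wpʳ c' k T)) (λ _ → id))
           k⨾oneʳ k⨾oneˡ
  where
  k : Label
  k = + 0
  pre : S ⇛ wpˡ c (wpʳ c' T)
  pre _ Sss' t ⇓c t' ⇓c' = ⊨cc' ⇓c ⇓c' Sss'

Stuck : (A : Automaton) → Ctrl A → Set
Stuck A n = ∀ s mt → ¬ (_⇒_ A) (n , s) mt

Runs : (A : Automaton) → Ctrl A × Sto A → Ctrl A × Sto A → Set
Runs A = Star (_⇒_ A)

module _ (A A' : Automaton) (L R J : Cond A A')
         (fin-stuck : Stuck A (fin A)) (fin'-stuck : Stuck A' (fin A'))
         (live : Live A A' L R J)
         {an : Ctrl A × Ctrl A' → Sto A × Sto A' → Set}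
         (valid : ValidAnnotation (∏ A A' L R J) an)
         (covered : ∀ i j → lift A A' an (i , j) ⊆ (L ∪ R ∪ J ∪ [_∣_] {A} {A'} (fin A) (fin A')))
  where

  annotation-at-fin : ∀ {n n' s s' t t'} →
    Runs A (n , s) (fin A , t) → Runs A' (n' , s') (fin A' , t') →
    an (n , n') (s , s') → an (fin A , fin A') (t , t')
  annotation-at-fin {n} {n'} run run' a with covered n n' _ (refl , a)
  ... | inj₁ inL with run
  ...   | ε           = ⊥-elim (fin-stuck _ _ (proj₂ (proj₁ live _ _ _ _ inL)))
  ...   | step ◅ run₁ = annotation-at-fin run₁ run' (valid _ _ _ _ a (inj₁ (inL , step , refl)))
  annotation-at-fin {n} {n'} run run' a | inj₂ (inj₁ inR) with run'
  ...   | ε            = ⊥-elim (fin'-stuck _ _ (proj₂ (proj₁ (proj₂ live) _ _ _ _ inR)))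
  ...   | step ◅ run'₁ = annotation-at-fin run run'₁ (valid _ _ _ _ a (inj₂ (inj₁ (inR , refl , step))))
  annotation-at-fin {n} {n'} run run' a | inj₂ (inj₂ (inj₁ inJ)) with run | run'
  ...   | ε          | _  = ⊥-elim (fin-stuck _ _ (proj₂ (proj₁ (proj₂ (proj₂ live) _ _ _ _ inJ))))
  ...   | _ ◅ _      | ε  = ⊥-elim (fin'-stuck _ _ (proj₂ (proj₂ (proj₂ (proj₂ live) _ _ _ _ inJ))))
  ...   | step ◅ run₁ | step' ◅ run'₁ =
    annotation-at-fin run₁ run'₁ (valid _ _ _ _ a (inj₂ (inj₂ (inJ , step , step'))))
  annotation-at-fin run run' a | inj₂ (inj₂ (inj₂ (refl , refl))) with run | run'
  ...   | ε        | ε        = a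
  ...   | step ◅ _ | _        = ⊥-elim (fin-stuck _ _ step)
  ...   | ε        | step ◅ _ = ⊥-elim (fin'-stuck _ _ step)

∈G⇒labs⊆labsG : ∀ {gs e d x} → (e , d) ∈G gs → x ∈ labs d → x ∈ labsG gs
∈G⇒labs⊆labsG here₁ x∈ = x∈
∈G⇒labs⊆labsG here₂ x∈ = ∈-++⁺ˡ x∈
∈G⇒labs⊆labsG {_ ↝ c □ _} (there ∈gs) x∈ = ∈-++⁺ʳ (labs c) (∈G⇒labs⊆labsG ∈gs x∈)

∈G⇒Unique : ∀ {gs e d} → (e , d) ∈G gs → Unique (labsG gs) → Unique (labs d)
∈G⇒Unique here₁ gs! = gs!
∈G⇒Unique {_ ↝ c □ _} here₂ gs! = Unique-++⁻ˡ (labs c) gs!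
∈G⇒Unique {_ ↝ c □ _} (there ∈gs) gs! = ∈G⇒Unique ∈gs (Unique-++⁻ʳ (labs c) gs!)

Sub⇒∈labs : ∀ {n c b} → Sub n c b → n ∈ labs c
Sub⇒∈labs sub-skip = here refl
Sub⇒∈labs sub-asgn = here refl
Sub⇒∈labs sub-if = here refl
Sub⇒∈labs sub-do = here refl
Sub⇒∈labs (sub-seqˡ sub) = ∈-++⁺ˡ (Sub⇒∈labs sub)
Sub⇒∈labs {c = c ⨟ _} (sub-seqʳ sub) = ∈-++⁺ʳ (labs c) (Sub⇒∈labs sub)
Sub⇒∈labs (sub-inif ∈gs sub) = there (∈G⇒labs⊆labsG ∈gs (Sub⇒∈labs sub))
Sub⇒∈labs (sub-indo ∈gs sub) = there (∈G⇒labs⊆labsG ∈gs (Sub⇒∈labs sub))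

aut-fin-stuck : ∀ c f → okf c f → Stuck (aut c f) (fin (aut c f))
aut-fin-stuck _ _ (_ , f∉) _ _ (as-pos sub _ _ _) = f∉ (Sub⇒∈labs sub)
aut-fin-stuck _ _ (_ , f∉) _ _ (as-neg sub _ _ _) = f∉ (Sub⇒∈labs sub)
aut-fin-stuck _ _ (_ , f∉) _ _ (as-skip sub _)    = f∉ (Sub⇒∈labs sub)

module _ {c₀ : Cmd} {f : Label} (okf₀ : okf c₀ f) where

  -- d sits inside c₀, and when d terminates control passes to the point labelled g.
  record Fragment (d : Cmd) (g : Label) : Set where
    field
      labs⊆  : ∀ {n} → n ∈ labs d → n ∈ labs c₀
      exit∈  : g ∈ labs c₀ ⊎ g ≡ f
      Sub⁺   : ∀ {n b} → Sub n d b → Sub n c₀ b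
      FSuc⁺  : ∀ {n m} → n ∈ labs d → FSuc n d g m → FSuc n c₀ f m
      unique : Unique (labs d)

    entry exit : CP c₀ f
    entry = cp (lab d) (inj₁ (labs⊆ (lab∈labs d)))
    exit  = cp g exit∈

    positive : ∀ {n} → n ∈ labs d → + 0 < n
    positive n∈ = All.lookup (proj₁ (proj₁ okf₀)) (labs⊆ n∈)

  open Fragment

  whole : Fragment c₀ f
  whole = record
    { labs⊆ = id ; exit∈ = inj₂ refl ; Sub⁺ = id ; FSuc⁺ = λ _ → id
    ; unique = proj₂ (proj₁ okf₀) }

  seqˡ : ∀ {c d g} → Fragment (c ⨟ d) g → Fragment c (lab d)
  seqˡ {c} {d} F = record
    { labs⊆  = λ n∈ → labs⊆ F (∈-++⁺ˡ n∈)
    ; exit∈  = inj₁ (labs⊆ F (∈-++⁺ʳ (labs c) (lab∈labs d)))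
    ; Sub⁺   = λ sub → Sub⁺ F (sub-seqˡ sub)
    ; FSuc⁺  = λ n∈ fs → FSuc⁺ F (∈-++⁺ˡ n∈) (fs-seqˡ n∈ fs)
    ; unique = Unique-++⁻ˡ (labs c) (unique F) }

  seqʳ : ∀ {c d g} → Fragment (c ⨟ d) g → Fragment d g
  seqʳ {c} {d} F = record
    { labs⊆  = λ n∈ → labs⊆ F (∈-++⁺ʳ (labs c) n∈)
    ; exit∈  = exit∈ F
    ; Sub⁺   = λ sub → Sub⁺ F (sub-seqʳ sub)
    ; FSuc⁺  = λ n∈ fs → FSuc⁺ F (∈-++⁺ʳ (labs c) n∈)
                           (fs-seqʳ (λ n∈c → Unique-++⇒Disjoint (labs c) (unique F) (n∈c , n∈)) fs)
    ; unique = Unique-++⁻ʳ (labs c) (unique F) }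

  branch-label≢ : ∀ {n gs e d m} → Unique (n ∷ labsG gs) → (e , d) ∈G gs → m ∈ labs d → m ≢ n
  branch-label≢ gs! ∈gs m∈ refl = Unique[x∷xs]⇒x∉xs gs! (∈G⇒labs⊆labsG ∈gs m∈)

  branch : ∀ {n gs e d g} → (e , d) ∈G gs → Fragment (IF n gs) g → Fragment d g
  branch ∈gs F@record { unique = _ ∷ gs! } = record
    { labs⊆  = λ n∈ → labs⊆ F (there (∈G⇒labs⊆labsG ∈gs n∈))
    ; exit∈  = exit∈ F
    ; Sub⁺   = λ sub → Sub⁺ F (sub-inif ∈gs sub)
    ; FSuc⁺  = λ n∈ fs → FSuc⁺ F (there (∈G⇒labs⊆labsG ∈gs n∈))
                           (fs-inif (branch-label≢ (unique F) ∈gs n∈) ∈gs n∈ fs)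
    ; unique = ∈G⇒Unique ∈gs gs! }

  body : ∀ {n gs e d g} → (e , d) ∈G gs → Fragment (DO n gs) g → Fragment d n
  body ∈gs F@record { unique = _ ∷ gs! } = record
    { labs⊆  = λ n∈ → labs⊆ F (there (∈G⇒labs⊆labsG ∈gs n∈))
    ; exit∈  = inj₁ (labs⊆ F (here refl))
    ; Sub⁺   = λ sub → Sub⁺ F (sub-indo ∈gs sub)
    ; FSuc⁺  = λ n∈ fs → FSuc⁺ F (there (∈G⇒labs⊆labsG ∈gs n∈))
                           (fs-indo (branch-label≢ (unique F) ∈gs n∈) ∈gs n∈ fs)
    ; unique = ∈G⇒Unique ∈gs gs! }

  ⇓⇒Runs : ∀ {d g s t} (F : Fragment d g) → ⟨ d , s ⟩⇓ t →
           Runs (aut c₀ f) (entry F , s) (exit F , t)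
  ⇓⇒Runs F ⇓skip = as-skip (Sub⁺ F sub-skip) (FSuc⁺ F (here refl) fs-skip) ◅ ε
  ⇓⇒Runs F ⇓asgn =
    as-neg (Sub⁺ F sub-asgn) st-asgn (neg-mono-< (positive F (here refl)))
           (FSuc⁺ F (here refl) fs-asgn) ◅ ε
  ⇓⇒Runs F (⇓seq ⇓c ⇓d) = ⇓⇒Runs (seqˡ F) ⇓c ◅◅ ⇓⇒Runs (seqʳ F) ⇓d
  ⇓⇒Runs F (⇓if {d = d} ∈gs e ⇓d) =
    as-pos (Sub⁺ F sub-if) (st-if ∈gs e) (positive (branch ∈gs F) (lab∈labs d)) refl
      ◅ ⇓⇒Runs (branch ∈gs F) ⇓d
  ⇓⇒Runs F (⇓loop {d = d} ∈gs e ⇓d ⇓do) =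
    as-pos (Sub⁺ F sub-do) (st-do ∈gs e) (positive (body ∈gs F) (lab∈labs d)) refl
      ◅ ⇓⇒Runs (body ∈gs F) ⇓d ◅◅ ⇓⇒Runs F ⇓do
  ⇓⇒Runs F (⇓done disabled) =
    as-neg (Sub⁺ F sub-do) (st-doexit disabled) (neg-mono-< (positive F (here refl)))
           (FSuc⁺ F (here refl) fs-do) ◅ ε

⇓⇒aut-Runs : ∀ c f {s t} → okf c f → ⟨ c , s ⟩⇓ t →
             Runs (aut c f) (init (aut c f) , s) (fin (aut c f) , t)
⇓⇒aut-Runs c f okf-c = ⇓⇒Runs okf-c (whole okf-c)

theorem7p1 :
  (c c' : Cmd) (f f' : ℤ) →
  WF c → WF c' → okf c f → okf c' f' →
  (L R J : Cond (aut c f) (aut c' f')) →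
  Live (aut c f) (aut c' f') L R J →
  (S T : Rel₂) →
  (an : Ctrl (aut c f) × Ctrl (aut c' f') → Store × Store → Set) →
  IsAnnotation (∏ (aut c f) (aut c' f') L R J) an S T →
  ValidAnnotation (∏ (aut c f) (aut c' f') L R J) an →
  (∀ i j → lift (aut c f) (aut c' f') an (i , j)
             ⊆ (L ∪ R ∪ J ∪ [_∣_] {aut c f} {aut c' f'} (fin (aut c f)) (fin (aut c' f')))) →
  ⊢ c ∣ c' ∶⟨ S ⟩⟨ T ⟩
theorem7p1 c c' f f' _ _ okf-c okf-c' L R J live S T an ((_ , S⊆init) , (fin⊆T , _)) valid covered =
  completeness λ ⇓c ⇓c' Sss' →
    fin⊆T _ (annotation-at-fin (aut c f) (aut c' f') L R J
               (aut-fin-stuck c f okf-c) (aut-fin-stuck c' f' okf-c') live valid covered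
               (⇓⇒aut-Runs c f okf-c ⇓c) (⇓⇒aut-Runs c' f' okf-c' ⇓c')
               (S⊆init _ Sss'))
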